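{- Let $(\Gamma,\varphi)\in\mathcal{P}$. Then $\mathtt{Recon}(\Gamma,\varphi)=(N,nil)$ for a $\beta$-normal form $N$ such that $\mathtt{Infer}(N)=(\Gamma,\varphi)$.
   Context: Terms (de Bruijn): $M,N::=\underline{n}\mid (M\,N)\mid\lambda.M$, $n\in\mathbb{N}^*$; application associates to the left. A $\beta$-normal form is a term with no subterm $((\lambda.M)\,N)$. Types: $\mathcal{A}$ a denumerable set of type variables; $\tau\in\mathcal{T}::=\alpha\mid u\to\tau$, $u\in\mathcal{U}::=\omega\mid u\wedge u\mid\tau$, $\wedge$ commutative, associative, neutral element $\omega$; $\to$ right-associative. Contexts $\Gamma::=nil\mid u.\Gamma$; $\Gamma_i$ the $i$-th element, $|\Gamma|$ the length; $\omega^{k}.\Gamma$ is $\Gamma$ prefixed by $k$ copies of $\omega$, $\omega^k$ alone is $\omega^k.nil$; $nil\wedge\Gamma=\Gamma\wedge nil=\Gamma$, $(u_1.\Gamma)\wedge(u_2.\Delta)=(u_1\wedge u_2).(\Gamma\wedge\Delta)$. Subsets: $\rho\in\mathcal{T}_C::=\alpha\mid\varphi\to\rho$; $\varphi\in\mathcal{T}_{NF}::=\alpha\mid v\to\varphi$; $v\in\mathcal{U}_C::=\omega\mid v\wedge v\mid\rho$; $\mathcal{C}$: contexts with elements in $\mathcal{U}_C$. $TV(\cdot)$: type variables occurring. $\mathtt{Infer}$ (defined up to renaming of type variables): $\mathtt{Infer}(\underline{n})=(\omega^{n-1}.\alpha.nil,\alpha)$, $\alpha$ fresh; $\mathtt{Infer}(\lambda.N')$: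 let $(\Gamma',\sigma)=\mathtt{Infer}(N')$; if $\Gamma'=u.\Gamma$ return $(\Gamma,u\to\sigma)$, else return $(nil,\omega\to\sigma)$; $\mathtt{Infer}(\underline{n}\,N_1\cdots N_m)$ ($m\ge1$): let $(\Gamma^i,\sigma_i)=\mathtt{Infer}(N_i)$, $\alpha$ fresh; return $((\omega^{n-1}.(\sigma_1\to\cdots\to\sigma_m\to\alpha).nil)\wedge\Gamma^1\wedge\cdots\wedge\Gamma^m,\alpha)$. $\mathcal{C}$-types: $\langle\Gamma\rangle\Rightarrow\varphi$ ($\Gamma\in\mathcal{C}$, $\varphi\in\mathcal{T}_{NF}$) or $\langle\Delta\rangle\Rightarrow$ ($\Delta\in\mathcal{C}$, $|\Delta|>0$). Polarity: $\alpha$ positive in $\alpha$; in $u\to\tau$ occurrences in $\tau$ keep sign, in $u$ reversed; $\wedge$ and context elements keep signs; in $\langle\Gamma\rangle\Rightarrow\varphi$ occurrences in $\varphi$ keep sign, in $\Gamma$ reversed. Closed: every type variable of $T$ has exactly one positive and one negative occurrence in $T$. Final occurrence: of $\alpha$ is $\alpha$, of $u\to\tau$ that of $\tau$; final occurrences of $\tau_1\wedge\cdots\wedge\tau_k$ are those of the $\tau_j$. $L(\langle\Gamma\rangle\Rightarrow)=L(\Gamma)$, $L(\langle\Gamma\rangle\Rightarrow\varphi)=L(\Gamma)\cup L(\varphi)$, $L(v.\Gamma)=\{v\}\cup L(\Gamma)$ if $v\ne\omega$ else $L(\Gamma)$, $L(nil)=\emptyset$, $L(v\to\varphi)=\{v\}\cup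 L(\varphi)$ if $v\neq\omega$ else $L(\varphi)$, $L(\alpha)=\emptyset$. Finally closed: the final occurrence of $\varphi$ is also the final occurrence of a type in $L(T)$. Held: for $T=\langle\Gamma\rangle\Rightarrow\varphi$, $T'$ is held in $T$ if $T'=\langle\Gamma'\rangle\Rightarrow$ or $\langle\Gamma'\rangle\Rightarrow\varphi$ with $\Gamma=\Gamma'\wedge\Delta$ for some context $\Delta$ and $\Gamma'$ not of the form $\omega^k$, $k\ge1$ ($\Gamma'=nil$ allowed in the second form); strictly held if $T'\ne T$. Minimally closed: no closed $\mathcal{C}$-type strictly held in $T$. Complete: closed, finally closed and minimally closed. Principal (inductively): a complete $T$ is principal if (a) $T=\langle\omega^{n-1}.\alpha.nil\rangle\Rightarrow\alpha$, $n\in\mathbb{N}^*$; or (b) $T=\langle nil\rangle\Rightarrow\omega\to\varphi$ with $\langle nil\rangle\Rightarrow\varphi$ principal; or (c) $T=\langle\Gamma\rangle\Rightarrow v\to\varphi$ with ($\Gamma\neq nil$ or $v\neq\omega$) and $\langle v.\Gamma\rangle\Rightarrow\varphi$ principal; or (d) $T=\langle\Gamma\rangle\Rightarrow\alpha$ with $\Gamma=(\omega^{n-1}.(\varphi_1\to\cdots\to\varphi_m\to\alpha).nil)\wedge\Gamma^1\wedge\cdots\wedge\Gamma^m$ for some $n\in\mathbb{N}^*$, $\Gamma^i\in\mathcal{C}$, $\varphi_i\in\mathcal{T}_{NF}$, each $\langle\Gamma^i\rangle\Rightarrow\varphi_i$ principal. $\mathcal{P}=\{(\Gamma,\varphi)\in\mathcal{C}\times\mathcal{T}_{NF}\mid\langle\Gamma\rangle\Rightarrow\varphi\text{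 principal}\}$. $FO(\alpha,\Gamma)=\{(i,\Gamma_i)\mid 1\le i\le|\Gamma|,\ \alpha\text{ is a final occurrence of }\Gamma_i\}$. Algorithm $\mathtt{Recon}(\Gamma,\tau)$: Case $(nil,\alpha)$: fail. Case $(\Gamma,\alpha)$: let $\{(i^1,u_1),\dots,(i^m,u_m)\}=FO(\alpha,\Gamma)$; if $m=1$ and $u_1=(\tau_1\to\cdots\to\tau_n\to\alpha)\wedge u'$ with $\alpha\notin TV(u')$, and if for every $1\le i\le n$ there is $\Gamma^i$ with $\Gamma=\Gamma^i\wedge X^i$ for some context $X^i$ and $\langle\Gamma^i\rangle\Rightarrow\tau_i$ principal, then let $(N_i,\Delta^i)=\mathtt{Recon}(\Gamma^i,\tau_i)$ for each $i$, $\Delta'=\omega^{i^1-1}.(\tau_1\to\cdots\to\tau_n\to\alpha).nil$, $\Gamma'=\Delta'\wedge\Gamma^1\wedge\cdots\wedge\Gamma^n$, and $\Delta$ such that $\Gamma=\Gamma'\wedge\Delta$ with $\Delta\neq\omega^j$ for all $1\le j\le|\Gamma|$; return $(\underline{i^1}\,N_1\cdots N_n,\ \Delta\wedge\Delta^1\wedge\cdots\wedge\Delta^n)$; otherwise fail. Case $(\Gamma,u\to\tau)$: if $\Gamma=nil$ and $u=\omega$ let $(N,\Delta)=\mathtt{Recon}(nil,\tau)$, else let $(N,\Delta)=\mathtt{Recon}(u.\Gamma,\tau)$; if $\Delta=nil$ return $(\lambda.N,\Delta)$, else fail. -}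

module Defs where

open import Data.Nat using (ℕ; zero; suc; _+_; _≤_; _<_; _≡ᵇ_)
open import Data.Bool using (Bool; true; false; not; if_then_else_)
open import Data.List using (List; []; _∷_; _++_; [_]; replicate; length; foldr; foldl; lookup; concatMap)
open import Data.List.Relation.Unary.Any using (Any)
open import Data.List.Relation.Binary.Pointwise using (Pointwise)
open import Data.Fin using (Fin; toℕ)
open import Data.Maybe using (Maybe; just; nothing)
open import Data.Product using (Σ; ∃; _×_; _,_)
open import Data.Sum using (_⊎_)
open import Data.Empty using (⊥)
open import Data.Unit using (⊤)
open import Relation.Nullary using (¬_)
open import Relation.Binary.PropositionalEquality using (_≡_; _≢_)
open import Function.Definitions using (Injective)

-- Terms (de Bruijn).  CONVENTION: var k denotes the index  \underline{k+1}.

data Tm : Set where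
  var : ℕ → Tm
  app : Tm → Tm → Tm
  lam : Tm → Tm

apps : Tm → List Tm → Tm
apps M Ns = foldl app M Ns

NotLam : Tm → Set
NotLam (lam _) = ⊥
NotLam _       = ⊤

data BetaNF : Tm → Set where
  var : ∀ {k} → BetaNF (var k)
  lam : ∀ {M} → BetaNF M → BetaNF (lam M)
  app : ∀ {M N} → NotLam M → BetaNF M → BetaNF N → BetaNF (app M N)

-- Types.  Type variables are natural numbers.
-- An element u of 𝒰 (an intersection) is a finite list of types; ω = [],
-- ∧ = _++_ ; commutativity/associativity is handled by the equivalence _≈U_.

data Ty : Set where
  tv  : ℕ → Ty
  _⇒_ : List Ty → Ty → Ty

infixr 5 _⇒_

U : Set
U = List Ty

ω : U
ω = []

Ctx : Set
Ctx = List U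

mutual
  data _≈T_ : Ty → Ty → Set where
    tv  : ∀ {a} → tv a ≈T tv a
    arr : ∀ {u u' τ τ'} → u ≈U u' → τ ≈T τ' → (u ⇒ τ) ≈T (u' ⇒ τ')

  data _≈U_ : U → U → Set where
    []    : [] ≈U []
    _∷_   : ∀ {x y xs ys} → x ≈T y → xs ≈U ys → (x ∷ xs) ≈U (y ∷ ys)
    swap  : ∀ {x y xs} → (x ∷ y ∷ xs) ≈U (y ∷ x ∷ xs)
    trans : ∀ {xs ys zs} → xs ≈U ys → ys ≈U zs → xs ≈U zs

_≈C_ : Ctx → Ctx → Set
Γ ≈C Δ = Pointwise _≈U_ Γ Δ

ω^ : ℕ → Ctx
ω^ k = replicate k ω

_∧C_ : Ctx → Ctx → Ctx
[]      ∧C Δ       = Δ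
(u ∷ Γ) ∧C []      = u ∷ Γ
(u ∷ Γ) ∧C (v ∷ Δ) = (u ++ v) ∷ (Γ ∧C Δ)

infixr 6 _∧C_

⋀C : List Ctx → Ctx
⋀C = foldr _∧C_ []

spine : List Ty → ℕ → Ty
spine τs a = foldr (λ τ r → [ τ ] ⇒ r) (tv a) τs

at : ℕ → Ty → Ctx
at k τ = ω^ k ++ [ [ τ ] ]

mutual
  renT : (ℕ → ℕ) → Ty → Ty
  renT ρ (tv a)  = tv (ρ a)
  renT ρ (u ⇒ τ) = renU ρ u ⇒ renT ρ τ

  renU : (ℕ → ℕ) → U → U
  renU ρ []      = []
  renU ρ (τ ∷ u) = renT ρ τ ∷ renU ρ u

renC : (ℕ → ℕ) → Ctx → Ctx
renC ρ []      = []
renC ρ (u ∷ Γ) = renU ρ u ∷ renC ρ Γ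

-- Fresh variables are produced by a counter; the second argument
-- accumulates the results for the arguments N1..Nm already traversed.
-- Returns nothing on terms outside the domain of Infer (β-redexes).

private
  argsTy : List (Ctx × Ty) → ℕ → Ty
  argsTy []             a = tv a
  argsTy ((_ , σ) ∷ xs) a = [ σ ] ⇒ argsTy xs a

  argsCtx : List (Ctx × Ty) → Ctx
  argsCtx []             = []
  argsCtx ((Γ , _) ∷ xs) = Γ ∧C argsCtx xs

inferH : Tm → List (Ctx × Ty) → ℕ → Maybe (Ctx × Ty × ℕ)
inferH (var k) [] c = just (at k (tv c) , tv c , suc c)
inferH (var k) (x ∷ xs) c =
  just (at k (argsTy (x ∷ xs) c) ∧C argsCtx (x ∷ xs) , tv c , suc c)
inferH (lam M) [] c with inferH M [] c
... | nothing                   = nothing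
... | just ([] , σ , c')        = just ([] , ω ⇒ σ , c')
... | just ((u ∷ Γ) , σ , c')   = just (Γ , u ⇒ σ , c')
inferH (lam M) (_ ∷ _) c = nothing
inferH (app M N) args c with inferH N [] c
... | nothing              = nothing
... | just (ΓN , σN , c')  = inferH M ((ΓN , σN) ∷ args) c'

-- Infer(N) = (Γ , φ), up to renaming of type variables (and AC of ∧)
InferIs : Tm → Ctx → Ty → Set
InferIs N Γ φ =
  Σ (ℕ → ℕ) λ ρ → Injective _≡_ _≡_ ρ ×
  Σ Ctx λ Γ₀ → Σ Ty λ σ₀ → Σ ℕ λ c →
    inferH N [] 0 ≡ just (Γ₀ , σ₀ , c) × renC ρ Γ₀ ≈C Γ × renT ρ σ₀ ≈T φ

mutual
  data IsTC : Ty → Set where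
    tv  : ∀ {a} → IsTC (tv a)
    arr : ∀ {φ ρ} → IsNF φ → IsTC ρ → IsTC ([ φ ] ⇒ ρ)

  data IsNF : Ty → Set where
    tv  : ∀ {a} → IsNF (tv a)
    arr : ∀ {v φ} → IsUC v → IsNF φ → IsNF (v ⇒ φ)

  data IsUC : U → Set where
    []  : IsUC []
    _∷_ : ∀ {ρ v} → IsTC ρ → IsUC v → IsUC (ρ ∷ v)

data IsCtxC : Ctx → Set where
  []  : IsCtxC []
  _∷_ : ∀ {v Γ} → IsUC v → IsCtxC Γ → IsCtxC (v ∷ Γ)

data CTy : Set where
  ⟨_⟩⇒_ : Ctx → Ty → CTy
  ⟨_⟩⇒∙ : Ctx → CTy

data IsCType : CTy → Set where
  full : ∀ {Γ φ} → IsCtxC Γ → IsNF φ → IsCType (⟨ Γ ⟩⇒ φ)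
  ctx  : ∀ {Δ} → IsCtxC Δ → 0 < length Δ → IsCType (⟨ Δ ⟩⇒∙)

-- number of occurrences of variable a with polarity p (true = positive)
mutual
  occT : Bool → ℕ → Ty → ℕ
  occT p a (tv b)  = if p then (if a ≡ᵇ b then 1 else 0) else 0
  occT p a (u ⇒ τ) = occU (not p) a u + occT p a τ

  occU : Bool → ℕ → U → ℕ
  occU p a []      = 0
  occU p a (τ ∷ u) = occT p a τ + occU p a u

occC : Bool → ℕ → Ctx → ℕ
occC p a []      = 0
occC p a (u ∷ Γ) = occU p a u + occC p a Γ

occ : Bool → ℕ → CTy → ℕ
occ p a (⟨ Γ ⟩⇒ φ) = occC (not p) a Γ + occT p a φ
occ p a (⟨ Γ ⟩⇒∙)  = occC (not p) a Γ

Closed : CTy → Set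
Closed T = ∀ a → (occ true a T ≡ 0 × occ false a T ≡ 0)
               ⊎ (occ true a T ≡ 1 × occ false a T ≡ 1)

finalVar : Ty → ℕ
finalVar (tv a)  = a
finalVar (u ⇒ τ) = finalVar τ

IsFinal : ℕ → U → Set
IsFinal a u = Any (λ τ → finalVar τ ≡ a) u

private
  nonω : U → List U
  nonω []      = []
  nonω (τ ∷ u) = [ τ ∷ u ]

LT : Ty → List U
LT (tv a)  = []
LT (v ⇒ φ) = nonω v ++ LT φ

LC : Ctx → List U
LC = concatMap nonω

FinallyClosed : Ctx → Ty → Set
FinallyClosed Γ φ = Any (IsFinal (finalVar φ)) (LC Γ ++ LT φ)

IsOmegas : Ctx → Set
IsOmegas Γ' = Σ ℕ λ k → 1 ≤ k × Γ' ≡ ω^ k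

data StrictlyHeld : CTy → Ctx → Ty → Set where
  ctx  : ∀ {Γ' Γ φ} (Δ : Ctx) → Γ ≈C (Γ' ∧C Δ) → ¬ IsOmegas Γ' →
         StrictlyHeld (⟨ Γ' ⟩⇒∙) Γ φ
  full : ∀ {Γ' Γ φ} (Δ : Ctx) → Γ ≈C (Γ' ∧C Δ) → ¬ IsOmegas Γ' →
         ¬ (Γ' ≈C Γ) → StrictlyHeld (⟨ Γ' ⟩⇒ φ) Γ φ

MinimallyClosed : Ctx → Ty → Set
MinimallyClosed Γ φ =
  ∀ T' → IsCType T' → StrictlyHeld T' Γ φ → ¬ Closed T'

Complete : Ctx → Ty → Set
Complete Γ φ = IsCType (⟨ Γ ⟩⇒ φ) × Closed (⟨ Γ ⟩⇒ φ)
             × FinallyClosed Γ φ × MinimallyClosed Γ φ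

mutual
  data Principal : Ctx → Ty → Set where
    pa : ∀ {a} (k : ℕ) → Complete (at k (tv a)) (tv a) →
         Principal (at k (tv a)) (tv a)
    pb : ∀ {φ} → Complete [] (ω ⇒ φ) → Principal [] φ →
         Principal [] (ω ⇒ φ)
    pc : ∀ {Γ v φ} → Complete Γ (v ⇒ φ) → (Γ ≢ [] ⊎ v ≢ ω) →
         Principal (v ∷ Γ) φ → Principal Γ (v ⇒ φ)
    pd : ∀ {Γ a} (k : ℕ) (φs : List Ty) (Γs : List Ctx) →
         Complete Γ (tv a) →
         Γ ≈C (at k (spine φs a) ∧C ⋀C Γs) →
         PrincipalAll Γs φs → Principal Γ (tv a)

  data PrincipalAll : List Ctx → List Ty → Set where
    []  : PrincipalAll [] []
    _∷_ : ∀ {Γ φ Γs φs} → Principal Γ φ → PrincipalAll Γs φs →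
          PrincipalAll (Γ ∷ Γs) (φ ∷ φs)

-- Recon, as a relation:  Recon Γ τ N Δ  means  Recon(Γ,τ) = (N,Δ)
-- (the algorithm contains choices "there is Γ^i ...", "Δ such that ...").

mutual
  data Recon : Ctx → Ty → Tm → Ctx → Set where
    rvar : ∀ {Γ a} (i : Fin (length Γ)) (τs : List Ty) (u' : U)
           (Γs : List Ctx) (Ns : List Tm) (Δs : List Ctx) (Δ : Ctx) →
           -- FO(α,Γ) = {(i, Γ_i)}
           IsFinal a (lookup Γ i) →
           (∀ j → IsFinal a (lookup Γ j) → j ≡ i) →
           lookup Γ i ≈U (spine τs a ∷ u') →
           occU true a u' + occU false a u' ≡ 0 →
           ReconArgs Γ τs Γs Ns Δs →
           Γ ≈C ((at (toℕ i) (spine τs a) ∧C ⋀C Γs) ∧C Δ) →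
           (∀ j → 1 ≤ j → j ≤ length Γ → Δ ≢ ω^ j) →
           Recon Γ (tv a) (apps (var (toℕ i)) Ns) (Δ ∧C ⋀C Δs)
    rlamω : ∀ {τ N} → Recon [] τ N [] → Recon [] (ω ⇒ τ) (lam N) []
    rlam  : ∀ {Γ u τ N} → (Γ ≢ [] ⊎ u ≢ ω) → Recon (u ∷ Γ) τ N [] →
            Recon Γ (u ⇒ τ) (lam N) []

  data ReconArgs (Γ : Ctx) : List Ty → List Ctx → List Tm → List Ctx → Set where
    []  : ReconArgs Γ [] [] [] []
    _∷_ : ∀ {τ Γk N Δk τs Γs Ns Δs} →
          (Σ Ctx λ X → Γ ≈C (Γk ∧C X)) × Principal Γk τ × Recon Γk τ N Δk →
          ReconArgs Γ τs Γs Ns Δs →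
          ReconArgs Γ (τ ∷ τs) (Γk ∷ Γs) (N ∷ Ns) (Δk ∷ Δs)

-- A principal derivation of ⟨Γ⟩⇒φ determines a β-normal term: the λs of rules (b)
-- and (c) over a variable applied, by rule (d), to the terms of the argument
-- derivations.  Recon follows the same derivation: since ⟨Γ⟩⇒α is closed, α occurs
-- positively exactly once, so FO(α, Γ) is the single position given by the
-- decomposition of rule (d), and α is absent from the rest of that position.
-- Infer rebuilds (Γ, φ) from this term up to a renaming of its fresh variables.  The
-- renaming is injective because closedness also makes the arguments' variables
-- pairwise disjoint and keeps α out of all of them.

module Submission where

open import Defs
open import Data.Bool using (true; false; not)
open import Data.Bool.Properties using (not-involutive)
open import Data.Fin using (Fin; toℕ)
import Data.Fin as Fin
open import Data.List using (List; []; _∷_; _++_; [_]; length; lookup; map)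
open import Data.List.Properties using (++-assoc; ++-identityʳ)
open import Data.List.Relation.Unary.All using (All)
open import Data.List.Relation.Unary.Any using (Any; here; there)
import Data.List.Relation.Unary.Any.Properties as Any
open import Data.List.Relation.Binary.Pointwise using (Pointwise; []; _∷_)
import Data.List.Relation.Binary.Pointwise.Properties as Pointwise
open import Data.Nat using (ℕ; zero; suc; _+_; _≤_; _<_; _⊔_; z≤n; s≤s; _<?_)
open import Data.Nat.Properties
open import Algebra.Properties.CommutativeSemigroup +-commutativeSemigroup
  using (interchange; x∙yz≈y∙xz)
open import Data.Maybe using (Maybe; just; nothing)
open import Data.Product using (Σ; ∃₂; ∃-syntax; _×_; _,_; proj₁; proj₂)
open import Data.Sum using (_⊎_; inj₁; inj₂)
open import Data.Unit using (⊤; tt)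
open import Function using (const; id)
open import Function.Definitions using (Injective)
open import Relation.Binary.PropositionalEquality
  using (_≡_; _≢_; refl; sym; cong; cong₂; subst; subst₂; module ≡-Reasoning)
import Relation.Binary.PropositionalEquality as ≡
open import Relation.Nullary using (¬_; yes; no; contradiction)
open import Relation.Unary using (Pred; _⊆_)
open import Level using (0ℓ)

-- Equality up to associativity and commutativity of ∧

mutual
  ≈T-refl : ∀ {τ} → τ ≈T τ
  ≈T-refl {tv a}  = tv
  ≈T-refl {u ⇒ τ} = arr ≈U-refl ≈T-refl

  ≈U-refl : ∀ {u} → u ≈U u
  ≈U-refl {[]}    = []
  ≈U-refl {τ ∷ u} = ≈T-refl ∷ ≈U-refl

mutual
  ≈T-sym : ∀ {τ τ'} → τ ≈T τ' → τ' ≈T τ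
  ≈T-sym tv        = tv
  ≈T-sym (arr p q) = arr (≈U-sym p) (≈T-sym q)

  ≈U-sym : ∀ {u u'} → u ≈U u' → u' ≈U u
  ≈U-sym []          = []
  ≈U-sym (p ∷ q)     = ≈T-sym p ∷ ≈U-sym q
  ≈U-sym swap        = swap
  ≈U-sym (trans p q) = trans (≈U-sym q) (≈U-sym p)

≈C-refl : ∀ {Γ} → Γ ≈C Γ
≈C-refl = Pointwise.refl ≈U-refl

≈C-sym : ∀ {Γ Δ} → Γ ≈C Δ → Δ ≈C Γ
≈C-sym = Pointwise.symmetric ≈U-sym

≈C-trans : ∀ {Γ Δ Θ} → Γ ≈C Δ → Δ ≈C Θ → Γ ≈C Θ
≈C-trans = Pointwise.transitive trans

≡⇒≈C : ∀ {Γ Δ} → Γ ≡ Δ → Γ ≈C Δ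
≡⇒≈C refl = ≈C-refl

pointwise⇒≈U : ∀ {u u'} → Pointwise _≈T_ u u' → u ≈U u'
pointwise⇒≈U []       = []
pointwise⇒≈U (p ∷ ps) = p ∷ pointwise⇒≈U ps

≈U-++⁺ : ∀ {u u' v v'} → u ≈U u' → v ≈U v' → (u ++ v) ≈U (u' ++ v')
≈U-++⁺ {v = v} {v'} p q = trans (left p) (right _ q)
  where
  left : ∀ {u u'} → u ≈U u' → (u ++ v) ≈U (u' ++ v)
  left []          = ≈U-refl
  left (p ∷ q)     = p ∷ left q
  left swap        = swap
  left (trans p q) = trans (left p) (left q)

  right : ∀ u → v ≈U v' → (u ++ v) ≈U (u ++ v')
  right []      q = q
  right (τ ∷ u) q = ≈T-refl ∷ right u q

++-comm-≈U : ∀ u v → (u ++ v) ≈U (v ++ u)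
++-comm-≈U []      v = subst (v ≈U_) (sym (++-identityʳ v)) ≈U-refl
++-comm-≈U (τ ∷ u) v = trans (≈T-refl ∷ ++-comm-≈U u v) (move τ v u)
  where
  move : ∀ τ v w → (τ ∷ (v ++ w)) ≈U (v ++ (τ ∷ w))
  move τ []      w = ≈U-refl
  move τ (σ ∷ v) w = trans swap (≈T-refl ∷ move τ v w)

∧C-identityʳ : ∀ Γ → Γ ∧C [] ≡ Γ
∧C-identityʳ []      = refl
∧C-identityʳ (u ∷ Γ) = refl

∧C-assoc : ∀ Γ Δ Θ → (Γ ∧C Δ) ∧C Θ ≡ Γ ∧C (Δ ∧C Θ)
∧C-assoc []      Δ       Θ       = refl
∧C-assoc (u ∷ Γ) []      Θ       = refl
∧C-assoc (u ∷ Γ) (v ∷ Δ) []      = refl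
∧C-assoc (u ∷ Γ) (v ∷ Δ) (w ∷ Θ) = cong₂ _∷_ (++-assoc u v w) (∧C-assoc Γ Δ Θ)

∧C-comm : ∀ Γ Δ → (Γ ∧C Δ) ≈C (Δ ∧C Γ)
∧C-comm []      Δ       = ≡⇒≈C (sym (∧C-identityʳ Δ))
∧C-comm (u ∷ Γ) []      = ≈C-refl
∧C-comm (u ∷ Γ) (v ∷ Δ) = ++-comm-≈U u v ∷ ∧C-comm Γ Δ

∧C-cong : ∀ {Γ Γ' Δ Δ'} → Γ ≈C Γ' → Δ ≈C Δ' → (Γ ∧C Δ) ≈C (Γ' ∧C Δ')
∧C-cong []       q        = q
∧C-cong (p ∷ ps) []       = p ∷ ps
∧C-cong (p ∷ ps) (q ∷ qs) = ≈U-++⁺ p q ∷ ∧C-cong ps qs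

at-cong : ∀ k {τ τ'} → τ ≈T τ' → at k τ ≈C at k τ'
at-cong zero    p = (p ∷ []) ∷ []
at-cong (suc k) p = [] ∷ at-cong k p

spine-cong : ∀ {τs τs'} a → Pointwise _≈T_ τs τs' → spine τs a ≈T spine τs' a
spine-cong a []       = tv
spine-cong a (p ∷ ps) = arr (p ∷ []) (spine-cong a ps)

renU-++ : ∀ ρ u v → renU ρ (u ++ v) ≡ renU ρ u ++ renU ρ v
renU-++ ρ []      v = refl
renU-++ ρ (τ ∷ u) v = cong (renT ρ τ ∷_) (renU-++ ρ u v)

renC-∧C : ∀ ρ Γ Δ → renC ρ (Γ ∧C Δ) ≡ renC ρ Γ ∧C renC ρ Δ
renC-∧C ρ []      Δ       = refl
renC-∧C ρ (u ∷ Γ) []      = refl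
renC-∧C ρ (u ∷ Γ) (v ∷ Δ) = cong₂ _∷_ (renU-++ ρ u v) (renC-∧C ρ Γ Δ)

renC-at : ∀ ρ k τ → renC ρ (at k τ) ≡ at k (renT ρ τ)
renC-at ρ zero    τ = refl
renC-at ρ (suc k) τ = cong ([] ∷_) (renC-at ρ k τ)

renT-spine : ∀ ρ τs a → renT ρ (spine τs a) ≡ spine (renU ρ τs) (ρ a)
renT-spine ρ []       a = refl
renT-spine ρ (τ ∷ τs) a = cong ([ renT ρ τ ] ⇒_) (renT-spine ρ τs a)

-- Type variables and their occurrences

data _∈T_ (b : ℕ) : Ty → Set where
  here : b ∈T tv b
  dom  : ∀ {u τ} → Any (b ∈T_) u → b ∈T (u ⇒ τ)
  cod  : ∀ {u τ} → b ∈T τ → b ∈T (u ⇒ τ)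

_∈U_ : ℕ → U → Set
b ∈U u = Any (b ∈T_) u

_∈C_ : ℕ → Ctx → Set
b ∈C Γ = Any (b ∈U_) Γ

Occurs : ℕ → Ctx → Ty → Set
Occurs b Γ φ = b ∈C Γ ⊎ b ∈T φ

OccursArgs : ℕ → List Ctx → List Ty → Set
OccursArgs b Γs φs = b ∈C ⋀C Γs ⊎ b ∈U φs

mutual
  ∈T-resp-≈ : ∀ {b τ τ'} → τ ≈T τ' → b ∈T τ → b ∈T τ'
  ∈T-resp-≈ tv        m       = m
  ∈T-resp-≈ (arr p q) (dom m) = dom (∈U-resp-≈ p m)
  ∈T-resp-≈ (arr p q) (cod m) = cod (∈T-resp-≈ q m)

  ∈U-resp-≈ : ∀ {b u u'} → u ≈U u' → b ∈U u → b ∈U u'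
  ∈U-resp-≈ (p ∷ q)     (here m)          = here (∈T-resp-≈ p m)
  ∈U-resp-≈ (p ∷ q)     (there m)         = there (∈U-resp-≈ q m)
  ∈U-resp-≈ swap        (here m)          = there (here m)
  ∈U-resp-≈ swap        (there (here m))  = here m
  ∈U-resp-≈ swap        (there (there m)) = there (there m)
  ∈U-resp-≈ (trans p q) m                 = ∈U-resp-≈ q (∈U-resp-≈ p m)

∈C-resp-≈ : ∀ {b Γ Γ'} → Γ ≈C Γ' → b ∈C Γ → b ∈C Γ'
∈C-resp-≈ (p ∷ ps) (here m)  = here (∈U-resp-≈ p m)
∈C-resp-≈ (p ∷ ps) (there m) = there (∈C-resp-≈ ps m)

mutual
  ∈T-ren : ∀ ρ {b τ} → b ∈T τ → ρ b ∈T renT ρ τ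
  ∈T-ren ρ here    = here
  ∈T-ren ρ (dom m) = dom (∈U-ren ρ m)
  ∈T-ren ρ (cod m) = cod (∈T-ren ρ m)

  ∈U-ren : ∀ ρ {b u} → b ∈U u → ρ b ∈U renU ρ u
  ∈U-ren ρ (here m)  = here (∈T-ren ρ m)
  ∈U-ren ρ (there m) = there (∈U-ren ρ m)

∈C-ren : ∀ ρ {b Γ} → b ∈C Γ → ρ b ∈C renC ρ Γ
∈C-ren ρ (here m)  = here (∈U-ren ρ m)
∈C-ren ρ (there m) = there (∈C-ren ρ m)

mutual
  renT-cong-∈ : ∀ {f g} τ → (∀ {x} → x ∈T τ → f x ≡ g x) → renT f τ ≡ renT g τ
  renT-cong-∈ (tv a)  h = cong tv (h here)
  renT-cong-∈ (u ⇒ τ) h =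
    cong₂ _⇒_ (renU-cong-∈ u (λ m → h (dom m))) (renT-cong-∈ τ (λ m → h (cod m)))

  renU-cong-∈ : ∀ {f g} u → (∀ {x} → x ∈U u → f x ≡ g x) → renU f u ≡ renU g u
  renU-cong-∈ []      h = refl
  renU-cong-∈ (τ ∷ u) h = cong₂ _∷_ (renT-cong-∈ τ (λ m → h (here m))) (renU-cong-∈ u (λ m → h (there m)))

renC-cong-∈ : ∀ {f g} Γ → (∀ {x} → x ∈C Γ → f x ≡ g x) → renC f Γ ≡ renC g Γ
renC-cong-∈ []      h = refl
renC-cong-∈ (u ∷ Γ) h = cong₂ _∷_ (renU-cong-∈ u (λ m → h (here m))) (renC-cong-∈ Γ (λ m → h (there m)))

∈C-∧C⁻ : ∀ {b} Γ Δ → b ∈C (Γ ∧C Δ) → b ∈C Γ ⊎ b ∈C Δ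
∈C-∧C⁻ []      Δ       m         = inj₂ m
∈C-∧C⁻ (u ∷ Γ) []      m         = inj₁ m
∈C-∧C⁻ (u ∷ Γ) (v ∷ Δ) (here m)  with Any.++⁻ u m
... | inj₁ m' = inj₁ (here m')
... | inj₂ m' = inj₂ (here m')
∈C-∧C⁻ (u ∷ Γ) (v ∷ Δ) (there m) with ∈C-∧C⁻ Γ Δ m
... | inj₁ m' = inj₁ (there m')
... | inj₂ m' = inj₂ (there m')

∈C-∧C⁺ˡ : ∀ {b Γ} Δ → b ∈C Γ → b ∈C (Γ ∧C Δ)
∈C-∧C⁺ˡ []      m         = subst (_ ∈C_) (sym (∧C-identityʳ _)) m
∈C-∧C⁺ˡ (v ∷ Δ) (here m)  = here (Any.++⁺ˡ m)
∈C-∧C⁺ˡ (v ∷ Δ) (there m) = there (∈C-∧C⁺ˡ Δ m)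

∈C-∧C⁺ʳ : ∀ {b} Γ {Δ} → b ∈C Δ → b ∈C (Γ ∧C Δ)
∈C-∧C⁺ʳ []      m         = m
∈C-∧C⁺ʳ (u ∷ Γ) (here m)  = here (Any.++⁺ʳ u m)
∈C-∧C⁺ʳ (u ∷ Γ) (there m) = there (∈C-∧C⁺ʳ Γ m)

∈C-at⁻ : ∀ {b} k {τ} → b ∈C at k τ → b ∈T τ
∈C-at⁻ zero    (here (here m)) = m
∈C-at⁻ (suc k) (there m)       = ∈C-at⁻ k m

∈C-at⁺ : ∀ {b} k {τ} → b ∈T τ → b ∈C at k τ
∈C-at⁺ zero    m = here (here m)
∈C-at⁺ (suc k) m = there (∈C-at⁺ k m)

∈T-spine⁻ : ∀ {b} τs a → b ∈T spine τs a → b ≡ a ⊎ b ∈U τs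
∈T-spine⁻ []       a here            = inj₁ refl
∈T-spine⁻ (τ ∷ τs) a (dom (here m))  = inj₂ (here m)
∈T-spine⁻ (τ ∷ τs) a (cod m)         with ∈T-spine⁻ τs a m
... | inj₁ e  = inj₁ e
... | inj₂ m' = inj₂ (there m')

∈T-spine⁺ : ∀ {b} τs a → b ≡ a ⊎ b ∈U τs → b ∈T spine τs a
∈T-spine⁺ []       a (inj₁ refl)      = here
∈T-spine⁺ (τ ∷ τs) a (inj₁ e)         = cod (∈T-spine⁺ τs a (inj₁ e))
∈T-spine⁺ (τ ∷ τs) a (inj₂ (here m))  = dom (here m)
∈T-spine⁺ (τ ∷ τs) a (inj₂ (there m)) = cod (∈T-spine⁺ τs a (inj₂ m))

mutual
  occT-resp-≈ : ∀ p a {τ τ'} → τ ≈T τ' → occT p a τ ≡ occT p a τ'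
  occT-resp-≈ p a tv        = refl
  occT-resp-≈ p a (arr q r) = cong₂ _+_ (occU-resp-≈ (not p) a q) (occT-resp-≈ p a r)

  occU-resp-≈ : ∀ p a {u u'} → u ≈U u' → occU p a u ≡ occU p a u'
  occU-resp-≈ p a []                    = refl
  occU-resp-≈ p a (q ∷ r)               = cong₂ _+_ (occT-resp-≈ p a q) (occU-resp-≈ p a r)
  occU-resp-≈ p a (swap {τ} {σ} {u})    = x∙yz≈y∙xz (occT p a τ) (occT p a σ) (occU p a u)
  occU-resp-≈ p a (trans q r)           = ≡.trans (occU-resp-≈ p a q) (occU-resp-≈ p a r)

occC-resp-≈ : ∀ p a {Γ Γ'} → Γ ≈C Γ' → occC p a Γ ≡ occC p a Γ'
occC-resp-≈ p a []      = refl
occC-resp-≈ p a (q ∷ r) = cong₂ _+_ (occU-resp-≈ p a q) (occC-resp-≈ p a r)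

occU-++ : ∀ p a u v → occU p a (u ++ v) ≡ occU p a u + occU p a v
occU-++ p a []      v = refl
occU-++ p a (τ ∷ u) v = ≡.trans (cong (occT p a τ +_) (occU-++ p a u v)) (sym (+-assoc (occT p a τ) _ _))

occC-∧C : ∀ p a Γ Δ → occC p a (Γ ∧C Δ) ≡ occC p a Γ + occC p a Δ
occC-∧C p a []      Δ       = refl
occC-∧C p a (u ∷ Γ) []      = sym (+-identityʳ _)
occC-∧C p a (u ∷ Γ) (v ∷ Δ) =
  ≡.trans (cong₂ _+_ (occU-++ p a u v) (occC-∧C p a Γ Δ)) (interchange (occU p a u) _ _ _)

occC-at : ∀ p a k τ → occC p a (at k τ) ≡ occT p a τ
occC-at p a zero    τ = ≡.trans (+-identityʳ _) (+-identityʳ _)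
occC-at p a (suc k) τ = occC-at p a k τ

occT-spine : ∀ p a τs b → occT p a (spine τs b) ≡ occU (not p) a τs + occT p a (tv b)
occT-spine p a []       b = refl
occT-spine p a (τ ∷ τs) b =
  ≡.trans (cong₂ _+_ (+-identityʳ (occT (not p) a τ)) (occT-spine p a τs b))
          (sym (+-assoc (occT (not p) a τ) _ _))

occT-self : ∀ a → occT true a (tv a) ≡ 1
occT-self zero    = refl
occT-self (suc a) = occT-self a

mutual
  ∈T⇒occT : ∀ {b τ} → b ∈T τ → ∃[ p ] 1 ≤ occT p b τ
  ∈T⇒occT {b} here = true , ≤-reflexive (sym (occT-self b))
  ∈T⇒occT {b} (dom {u} m) with ∈U⇒occU m
  ... | p , h = not p , m≤n⇒m≤n+o _ (subst (λ q → 1 ≤ occU q b u) (sym (not-involutive p)) h)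
  ∈T⇒occT (cod m) with ∈T⇒occT m
  ... | p , h = p , m≤n⇒m≤o+n _ h

  ∈U⇒occU : ∀ {b u} → b ∈U u → ∃[ p ] 1 ≤ occU p b u
  ∈U⇒occU (here m) with ∈T⇒occT m
  ... | p , h = p , m≤n⇒m≤n+o _ h
  ∈U⇒occU (there m) with ∈U⇒occU m
  ... | p , h = p , m≤n⇒m≤o+n _ h

∈C⇒occC : ∀ {b Γ} → b ∈C Γ → ∃[ p ] 1 ≤ occC p b Γ
∈C⇒occC (here m) with ∈U⇒occU m
... | p , h = p , m≤n⇒m≤n+o _ h
∈C⇒occC (there m) with ∈C⇒occC m
... | p , h = p , m≤n⇒m≤o+n _ h

Occurs⇒occ : ∀ {b Γ φ} → Occurs b Γ φ → ∃[ p ] 1 ≤ occ p b (⟨ Γ ⟩⇒ φ)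
Occurs⇒occ {b} {Γ} (inj₁ m) with ∈C⇒occC m
... | p , h = not p , m≤n⇒m≤n+o _ (subst (λ q → 1 ≤ occC q b Γ) (sym (not-involutive p)) h)
Occurs⇒occ (inj₂ m) with ∈T⇒occT m
... | p , h = p , m≤n⇒m≤o+n _ h

finalVar-resp-≈ : ∀ {τ τ'} → τ ≈T τ' → finalVar τ ≡ finalVar τ'
finalVar-resp-≈ tv        = refl
finalVar-resp-≈ (arr p q) = finalVar-resp-≈ q

finalVar-spine : ∀ τs a → finalVar (spine τs a) ≡ a
finalVar-spine []       a = refl
finalVar-spine (τ ∷ τs) a = finalVar-spine τs a

IsFinal-resp-≈ : ∀ {a u u'} → u ≈U u' → IsFinal a u → IsFinal a u'
IsFinal-resp-≈ (p ∷ q)     (here e)          = here (≡.trans (sym (finalVar-resp-≈ p)) e)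
IsFinal-resp-≈ (p ∷ q)     (there m)         = there (IsFinal-resp-≈ q m)
IsFinal-resp-≈ swap        (here e)          = there (here e)
IsFinal-resp-≈ swap        (there (here e))  = here e
IsFinal-resp-≈ swap        (there (there m)) = there (there m)
IsFinal-resp-≈ (trans p q) m                 = IsFinal-resp-≈ q (IsFinal-resp-≈ p m)

finalVar⇒occT : ∀ {a} τ → finalVar τ ≡ a → 1 ≤ occT true a τ
finalVar⇒occT (tv b)  refl = ≤-reflexive (sym (occT-self b))
finalVar⇒occT (u ⇒ τ) e    = m≤n⇒m≤o+n _ (finalVar⇒occT τ e)

IsFinal⇒occU : ∀ {a u} → IsFinal a u → 1 ≤ occU true a u
IsFinal⇒occU (here {τ} e) = m≤n⇒m≤n+o _ (finalVar⇒occT τ e)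
IsFinal⇒occU (there m)    = m≤n⇒m≤o+n _ (IsFinal⇒occU m)

Closed⇒occ≤1 : ∀ {T} → Closed T → ∀ p b → occ p b T ≤ 1
Closed⇒occ≤1 cl true  b with cl b
... | inj₁ (e , _) = subst (_≤ 1) (sym e) z≤n
... | inj₂ (e , _) = ≤-reflexive e
Closed⇒occ≤1 cl false b with cl b
... | inj₁ (_ , e) = subst (_≤ 1) (sym e) z≤n
... | inj₂ (_ , e) = ≤-reflexive e

Closed⇒occ≡1 : ∀ {T p b} → Closed T → 1 ≤ occ p b T → ∀ q → occ q b T ≡ 1
Closed⇒occ≡1 {p = p} {b} cl h q with cl b
Closed⇒occ≡1 {p = true}  cl h q | inj₁ (e , _) = contradiction (subst (1 ≤_) e h) λ ()
Closed⇒occ≡1 {p = false} cl h q | inj₁ (_ , e) = contradiction (subst (1 ≤_) e h) λ ()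
Closed⇒occ≡1 cl h true  | inj₂ (e , _) = e
Closed⇒occ≡1 cl h false | inj₂ (_ , e) = e

OccursArgs-∷⁻ : ∀ {b Γ φ Γs φs} → OccursArgs b (Γ ∷ Γs) (φ ∷ φs) → Occurs b Γ φ ⊎ OccursArgs b Γs φs
OccursArgs-∷⁻ {Γ = Γ} {Γs = Γs} (inj₁ m) with ∈C-∧C⁻ Γ (⋀C Γs) m
... | inj₁ m' = inj₁ (inj₁ m')
... | inj₂ m' = inj₂ (inj₁ m')
OccursArgs-∷⁻ (inj₂ (here m))  = inj₁ (inj₂ m)
OccursArgs-∷⁻ (inj₂ (there m)) = inj₂ (inj₂ m)

OccursArgs-∷⁺ˡ : ∀ {b Γ φ Γs φs} → Occurs b Γ φ → OccursArgs b (Γ ∷ Γs) (φ ∷ φs)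
OccursArgs-∷⁺ˡ {Γs = Γs} (inj₁ m) = inj₁ (∈C-∧C⁺ˡ (⋀C Γs) m)
OccursArgs-∷⁺ˡ           (inj₂ m) = inj₂ (here m)

OccursArgs-∷⁺ʳ : ∀ {b Γ φ Γs φs} → OccursArgs b Γs φs → OccursArgs b (Γ ∷ Γs) (φ ∷ φs)
OccursArgs-∷⁺ʳ {Γ = Γ} (inj₁ m) = inj₁ (∈C-∧C⁺ʳ Γ m)
OccursArgs-∷⁺ʳ         (inj₂ m) = inj₂ (there m)

Occurs-ren : ∀ {ρ x Γ₀ σ₀ Γ φ} → renC ρ Γ₀ ≈C Γ → renT ρ σ₀ ≈T φ → Occurs x Γ₀ σ₀ → Occurs (ρ x) Γ φ
Occurs-ren {ρ} rΓ rσ (inj₁ m) = inj₁ (∈C-resp-≈ rΓ (∈C-ren ρ m))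
Occurs-ren {ρ} rΓ rσ (inj₂ m) = inj₂ (∈T-resp-≈ rσ (∈T-ren ρ m))

OccursArgs-ren : ∀ {ρ x Γ₀s σ₀s Γs φs} → renC ρ (⋀C Γ₀s) ≈C ⋀C Γs → Pointwise _≈T_ (renU ρ σ₀s) φs →
                 OccursArgs x Γ₀s σ₀s → OccursArgs (ρ x) Γs φs
OccursArgs-ren {ρ} rΓ rσ (inj₁ m) = inj₁ (∈C-resp-≈ rΓ (∈C-ren ρ m))
OccursArgs-ren {ρ} rΓ rσ (inj₂ m) = inj₂ (∈U-resp-≈ (pointwise⇒≈U rσ) (∈U-ren ρ m))

-- Principal derivations and reconstruction

mutual
  term : ∀ {Γ φ} → Principal Γ φ → Tm
  term (pa k _)          = var k
  term (pb _ P)          = lam (term P)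
  term (pc _ _ P)        = lam (term P)
  term (pd k _ _ _ _ Ps) = apps (var k) (terms Ps)

  terms : ∀ {Γs φs} → PrincipalAll Γs φs → List Tm
  terms []       = []
  terms (P ∷ Ps) = term P ∷ terms Ps

Principal⇒Closed : ∀ {Γ φ} → Principal Γ φ → Closed (⟨ Γ ⟩⇒ φ)
Principal⇒Closed (pa _ (_ , cl , _))          = cl
Principal⇒Closed (pb (_ , cl , _) _)          = cl
Principal⇒Closed (pc (_ , cl , _) _ _)        = cl
Principal⇒Closed (pd _ _ _ (_ , cl , _) _ _)  = cl

occC-head : ∀ {Γ} k φs a Γs p b → Γ ≈C (at k (spine φs a) ∧C ⋀C Γs) →
            occC p b Γ ≡ occT p b (spine φs a) + occC p b (⋀C Γs)
occC-head {Γ} k φs a Γs p b eq = begin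
  occC p b Γ                                          ≡⟨ occC-resp-≈ p b eq ⟩
  occC p b (at k (spine φs a) ∧C ⋀C Γs)               ≡⟨ occC-∧C p b (at k _) (⋀C Γs) ⟩
  occC p b (at k (spine φs a)) + occC p b (⋀C Γs)     ≡⟨ cong (_+ occC p b (⋀C Γs)) (occC-at p b k _) ⟩
  occT p b (spine φs a) + occC p b (⋀C Γs)            ∎
  where open ≡-Reasoning

-- Positive occurrences of b in the C-types ⟨Γᵢ⟩⇒φᵢ of the arguments, taken together.
occArgs : ℕ → List Ctx → List Ty → ℕ
occArgs b Γs φs = occC false b (⋀C Γs) + occU true b φs

occArgs-∷ : ∀ b Γ Γs φ φs → occArgs b (Γ ∷ Γs) (φ ∷ φs) ≡ occ true b (⟨ Γ ⟩⇒ φ) + occArgs b Γs φs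
occArgs-∷ b Γ Γs φ φs =
  ≡.trans (cong (_+ occU true b (φ ∷ φs)) (occC-∧C false b Γ (⋀C Γs)))
          (interchange (occC false b Γ) _ _ _)

occ-head : ∀ {Γ} k φs a Γs b → Γ ≈C (at k (spine φs a) ∧C ⋀C Γs) →
           occ true b (⟨ Γ ⟩⇒ tv a) ≡ occArgs b Γs φs + occT true b (tv a)
occ-head {Γ} k φs a Γs b eq = cong (_+ occT true b (tv a)) (begin
  occC false b Γ                                        ≡⟨ occC-head k φs a Γs false b eq ⟩
  occT false b (spine φs a) + occC false b (⋀C Γs)      ≡⟨ cong (_+ occC false b (⋀C Γs))
                                                             (≡.trans (occT-spine false b φs a) (+-identityʳ _)) ⟩
  occU true b φs + occC false b (⋀C Γs)                 ≡⟨ +-comm (occU true b φs) _ ⟩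
  occArgs b Γs φs                                       ∎)
  where open ≡-Reasoning

OccursArgs⇒occArgs : ∀ {b Γs φs} → PrincipalAll Γs φs → OccursArgs b Γs φs → 1 ≤ occArgs b Γs φs
OccursArgs⇒occArgs [] (inj₁ ())
OccursArgs⇒occArgs [] (inj₂ ())
OccursArgs⇒occArgs {b} {Γ ∷ Γs} {φ ∷ φs} (P ∷ Ps) m
  rewrite occArgs-∷ b Γ Γs φ φs with OccursArgs-∷⁻ {Γ = Γ} {Γs = Γs} m
... | inj₁ m' = m≤n⇒m≤n+o _ (≤-reflexive (sym (Closed⇒occ≡1 {⟨ Γ ⟩⇒ φ} (Principal⇒Closed P) (proj₂ (Occurs⇒occ m')) true)))
... | inj₂ m' = m≤n⇒m≤o+n (occ true b (⟨ Γ ⟩⇒ φ)) (OccursArgs⇒occArgs Ps m')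

nthOrω : ℕ → Ctx → U
nthOrω _       []      = ω
nthOrω zero    (u ∷ Γ) = u
nthOrω (suc k) (u ∷ Γ) = nthOrω k Γ

occU-nthOrω≤occC : ∀ p a k Γ → occU p a (nthOrω k Γ) ≤ occC p a Γ
occU-nthOrω≤occC p a k       []      = z≤n
occU-nthOrω≤occC p a zero    (u ∷ Γ) = m≤m+n _ _
occU-nthOrω≤occC p a (suc k) (u ∷ Γ) = m≤n⇒m≤o+n (occU p a u) (occU-nthOrω≤occC p a k Γ)

occU-lookup≤occC : ∀ p a Γ (i : Fin (length Γ)) → occU p a (lookup Γ i) ≤ occC p a Γ
occU-lookup≤occC p a (u ∷ Γ) Fin.zero    = m≤m+n _ _
occU-lookup≤occC p a (u ∷ Γ) (Fin.suc i) = m≤n⇒m≤o+n (occU p a u) (occU-lookup≤occC p a Γ i)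

occU-lookup²≤occC : ∀ p a Γ (i j : Fin (length Γ)) → i ≢ j →
                    occU p a (lookup Γ i) + occU p a (lookup Γ j) ≤ occC p a Γ
occU-lookup²≤occC p a (u ∷ Γ) Fin.zero    Fin.zero    i≢j = contradiction refl i≢j
occU-lookup²≤occC p a (u ∷ Γ) Fin.zero    (Fin.suc j) i≢j = +-monoʳ-≤ (occU p a u) (occU-lookup≤occC p a Γ j)
occU-lookup²≤occC p a (u ∷ Γ) (Fin.suc i) Fin.zero    i≢j =
  subst (_≤ occC p a (u ∷ Γ)) (+-comm (occU p a u) _) (+-monoʳ-≤ (occU p a u) (occU-lookup≤occC p a Γ i))
occU-lookup²≤occC p a (u ∷ Γ) (Fin.suc i) (Fin.suc j) i≢j =
  m≤n⇒m≤o+n (occU p a u) (occU-lookup²≤occC p a Γ i j (λ e → i≢j (cong Fin.suc e)))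

head-position : ∀ k S W {Γ} → Γ ≈C (at k S ∧C W) →
                Σ (Fin (length Γ)) λ i → toℕ i ≡ k × lookup Γ i ≈U (S ∷ nthOrω k W)
head-position zero    S []      (p ∷ _)  = Fin.zero , refl , p
head-position zero    S (w ∷ W) (p ∷ _)  = Fin.zero , refl , p
head-position (suc k) S []      (_ ∷ ps) with head-position k S [] (≈C-trans ps (≡⇒≈C (sym (∧C-identityʳ (at k S)))))
... | i , e , p = Fin.suc i , cong suc e , p
head-position (suc k) S (w ∷ W) (_ ∷ ps) with head-position k S W ps
... | i , e , p = Fin.suc i , cong suc e , p

⋀C-nils : ∀ (Ns : List Tm) → ⋀C (map (const []) Ns) ≡ []
⋀C-nils []       = refl
⋀C-nils (N ∷ Ns) = ⋀C-nils Ns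

head-var-occurrences : ∀ {Γ a} k φs Γs → Closed (⟨ Γ ⟩⇒ tv a) → Γ ≈C (at k (spine φs a) ∧C ⋀C Γs) →
                       occC true a Γ ≤ 1 × occC true a (⋀C Γs) ≡ 0 × occC false a (⋀C Γs) ≡ 0
head-var-occurrences {Γ} {a} k φs Γs cl eq = pos-in-Γ , pos-in-W , neg-in-W
  where
  W = ⋀C Γs
  neg-in-Γ : occC false a Γ ≡ 0
  neg-in-Γ = n≤0⇒n≡0 (+-cancelʳ-≤ 1 _ 0
    (subst (λ n → occC false a Γ + n ≤ 1) (occT-self a) (Closed⇒occ≤1 {⟨ Γ ⟩⇒ tv a} cl true a)))
  pos-in-Γ : occC true a Γ ≤ 1
  pos-in-Γ = subst (_≤ 1) (+-identityʳ _) (Closed⇒occ≤1 {⟨ Γ ⟩⇒ tv a} cl false a)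
  pos-in-W : occC true a W ≡ 0
  pos-in-W = n≤0⇒n≡0 (+-cancelˡ-≤ 1 _ 0 (≤-trans
    (+-monoˡ-≤ (occC true a W) (finalVar⇒occT (spine φs a) (finalVar-spine φs a)))
    (≤-trans (≤-reflexive (sym (occC-head k φs a Γs true a eq))) pos-in-Γ)))
  neg-in-W : occC false a W ≡ 0
  neg-in-W = n≤0⇒n≡0 (m+n≤o⇒n≤o (occT false a (spine φs a))
    (≤-trans (≤-reflexive (sym (occC-head k φs a Γs false a eq))) (≤-reflexive neg-in-Γ)))

-- The head variable a occurs positively once in ⟨Γ⟩⇒α, so it is a final occurrence
-- of exactly one Γᵢ and does not occur in the rest u' of that Γᵢ.
recon-head : ∀ {Γ a} k φs Γs Ns → Closed (⟨ Γ ⟩⇒ tv a) →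
             Γ ≈C (at k (spine φs a) ∧C ⋀C Γs) →
             ReconArgs Γ φs Γs Ns (map (const []) Ns) →
             Recon Γ (tv a) (apps (var k) Ns) []
recon-head {Γ} {a} k φs Γs Ns cl eq args
  with head-position k (spine φs a) (⋀C Γs) eq | head-var-occurrences k φs Γs cl eq
... | i , toℕi≡k , lookup-i | pos-in-Γ , pos-in-W , neg-in-W =
  subst₂ (Recon Γ (tv a)) (cong (λ n → apps (var n) Ns) toℕi≡k) (⋀C-nils Ns)
    (rvar i φs u' Γs Ns (map (const []) Ns) [] final-i unique lookup-i u'-fresh args eq′ nonω)
  where
  S = spine φs a
  W = ⋀C Γs
  u' = nthOrω k W
  u'-fresh : occU true a u' + occU false a u' ≡ 0
  u'-fresh = cong₂ _+_
    (n≤0⇒n≡0 (≤-trans (occU-nthOrω≤occC true a k W) (≤-reflexive pos-in-W)))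
    (n≤0⇒n≡0 (≤-trans (occU-nthOrω≤occC false a k W) (≤-reflexive neg-in-W)))
  final-i : IsFinal a (lookup Γ i)
  final-i = IsFinal-resp-≈ (≈U-sym lookup-i) (here (finalVar-spine φs a))
  unique : ∀ j → IsFinal a (lookup Γ j) → j ≡ i
  unique j final-j with j Fin.≟ i
  ... | yes j≡i = j≡i
  ... | no j≢i  = contradiction (≤-trans (+-mono-≤ (IsFinal⇒occU final-j) (IsFinal⇒occU final-i))
                                          (≤-trans (occU-lookup²≤occC true a Γ j i j≢i) pos-in-Γ))
                                λ { (s≤s ()) }
  eq′ : Γ ≈C ((at (toℕ i) S ∧C W) ∧C [])
  eq′ = subst (Γ ≈C_) (sym (≡.trans (∧C-identityʳ _) (cong (λ n → at n S ∧C W) toℕi≡k))) eq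
  nonω : ∀ j → 1 ≤ j → j ≤ length Γ → [] ≢ ω^ j
  nonω (suc j) _ _ ()

mutual
  recon : ∀ {Γ φ} (P : Principal Γ φ) → Recon Γ φ (term P) []
  recon (pa {a} k (_ , cl , _))         =
    recon-head k [] [] [] cl (≡⇒≈C (sym (∧C-identityʳ (at k (tv a))))) []
  recon (pb _ P)                        = rlamω (recon P)
  recon (pc _ nontrivial P)             = rlam nontrivial (recon P)
  recon (pd k φs Γs (_ , cl , _) eq Ps) =
    recon-head k φs Γs (terms Ps) cl eq (recon-args (at k (spine φs _)) eq Ps)

  recon-args : ∀ {Γ Γs φs} Θ → Γ ≈C (Θ ∧C ⋀C Γs) → (Ps : PrincipalAll Γs φs) →
               ReconArgs Γ φs Γs (terms Ps) (map (const []) (terms Ps))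
  recon-args Θ eq []                        = []
  recon-args {Γ} {Γ₁ ∷ Γs} Θ eq (P ∷ Ps) =
    ((Θ ∧C ⋀C Γs , split) , P , recon P) ∷ recon-args (Θ ∧C Γ₁) eq′ Ps
    where
    split : Γ ≈C (Γ₁ ∧C (Θ ∧C ⋀C Γs))
    split = ≈C-trans eq (≈C-trans (≡⇒≈C (sym (∧C-assoc Θ Γ₁ (⋀C Γs))))
              (≈C-trans (∧C-cong (∧C-comm Θ Γ₁) ≈C-refl) (≡⇒≈C (∧C-assoc Γ₁ Θ (⋀C Γs)))))
    eq′ : Γ ≈C ((Θ ∧C Γ₁) ∧C ⋀C Γs)
    eq′ = ≈C-trans eq (≡⇒≈C (sym (∧C-assoc Θ Γ₁ (⋀C Γs))))

apps-BetaNF : ∀ {M Ns} → BetaNF M → NotLam M → All BetaNF Ns → BetaNF (apps M Ns)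
apps-BetaNF nf-M notLam All.[]            = nf-M
apps-BetaNF nf-M notLam (nf-N All.∷ nf-Ns) = apps-BetaNF (app notLam nf-M nf-N) tt nf-Ns

mutual
  term-BetaNF : ∀ {Γ φ} (P : Principal Γ φ) → BetaNF (term P)
  term-BetaNF (pa k _)          = var
  term-BetaNF (pb _ P)          = lam (term-BetaNF P)
  term-BetaNF (pc _ _ P)        = lam (term-BetaNF P)
  term-BetaNF (pd k _ _ _ _ Ps) = apps-BetaNF var tt (terms-BetaNF Ps)

  terms-BetaNF : ∀ {Γs φs} (Ps : PrincipalAll Γs φs) → All BetaNF (terms Ps)
  terms-BetaNF []       = All.[]
  terms-BetaNF (P ∷ Ps) = term-BetaNF P All.∷ terms-BetaNF Ps

-- Renamings injective on an interval

Between : ℕ → ℕ → Pred ℕ 0ℓ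
Between c c' x = c ≤ x × x < c'

InjectiveOn : Pred ℕ 0ℓ → (ℕ → ℕ) → Set
InjectiveOn P f = ∀ {x y} → P x → P y → f x ≡ f y → x ≡ y

InjectiveOn-⊆ : ∀ {P Q f} → Q ⊆ P → InjectiveOn P f → InjectiveOn Q f
InjectiveOn-⊆ Q⊆P inj qx qy = inj (Q⊆P qx) (Q⊆P qy)

glue : ℕ → (ℕ → ℕ) → (ℕ → ℕ) → ℕ → ℕ
glue m f g x with x <? m
... | yes _ = f x
... | no  _ = g x

glue-< : ∀ {m f g x} → x < m → glue m f g x ≡ f x
glue-< {m} {x = x} x<m with x <? m
... | yes _   = refl
... | no  x≮m = contradiction x<m x≮m

glue-≥ : ∀ {m f g x} → m ≤ x → glue m f g x ≡ g x
glue-≥ {m} {x = x} m≤x with x <? m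
... | yes x<m = contradiction m≤x (<⇒≱ x<m)
... | no  _   = refl

glue-injectiveOn : ∀ {P m f g} →
                   InjectiveOn (λ x → P x × x < m) f → InjectiveOn (λ x → P x × m ≤ x) g →
                   (∀ {x y} → P x → x < m → P y → m ≤ y → f x ≢ g y) →
                   InjectiveOn P (glue m f g)
glue-injectiveOn {m = m} {f} {g} inj-f inj-g apart {x} {y} px py e
  with ≤-<-connex m x | ≤-<-connex m y
... | inj₂ x<m | inj₂ y<m = inj-f (px , x<m) (py , y<m) (≡.trans (sym (glue-< x<m)) (≡.trans e (glue-< y<m)))
... | inj₁ m≤x | inj₁ m≤y = inj-g (px , m≤x) (py , m≤y) (≡.trans (sym (glue-≥ m≤x)) (≡.trans e (glue-≥ m≤y)))
... | inj₂ x<m | inj₁ m≤y =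
  contradiction (≡.trans (sym (glue-< x<m)) (≡.trans e (glue-≥ m≤y))) (apart px x<m py m≤y)
... | inj₁ m≤x | inj₂ y<m =
  contradiction (≡.trans (sym (glue-< y<m)) (≡.trans (sym e) (glue-≥ m≤x))) (apart py y<m px m≤x)

glue-injectiveOn-Between : ∀ {c m c' f g} → InjectiveOn (Between c m) f → InjectiveOn (Between m c') g →
                           (∀ {x y} → Between c m x → Between m c' y → f x ≢ g y) →
                           InjectiveOn (Between c c') (glue m f g)
glue-injectiveOn-Between inj-f inj-g apart = glue-injectiveOn
  (InjectiveOn-⊆ (λ ((c≤x , _) , x<m) → c≤x , x<m) inj-f)
  (InjectiveOn-⊆ (λ ((_ , x<c') , m≤x) → m≤x , x<c') inj-g)
  (λ (c≤x , _) x<m (_ , y<c') m≤y → apart (c≤x , x<m) (m≤y , y<c'))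

bound : ℕ → (ℕ → ℕ) → ℕ
bound zero    ρ = 0
bound (suc m) ρ = suc (ρ m) ⊔ bound m ρ

<bound : ∀ {x} m ρ → x < m → ρ x < bound m ρ
<bound {x} (suc m) ρ x<1+m with m<1+n⇒m<n∨m≡n x<1+m
... | inj₁ x<m  = ≤-trans (<bound m ρ x<m) (m≤n⊔m (suc (ρ m)) (bound m ρ))
... | inj₂ refl = m≤m⊔n (suc (ρ x)) (bound m ρ)

-- ρ is made injective everywhere by moving [m, ∞) above the image of [0, m).
InjectiveOn-extend : ∀ m ρ → InjectiveOn (Between 0 m) ρ →
                     Σ (ℕ → ℕ) λ ρ′ → Injective _≡_ _≡_ ρ′ × (∀ {x} → x < m → ρ′ x ≡ ρ x)
InjectiveOn-extend m ρ inj = glue m ρ (bound m ρ +_) , injective , glue-<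
  where
  injectiveOn : InjectiveOn (λ _ → ⊤) (glue m ρ (bound m ρ +_))
  injectiveOn = glue-injectiveOn
    (InjectiveOn-⊆ (λ (_ , x<m) → z≤n , x<m) inj)
    (λ _ _ → +-cancelˡ-≡ (bound m ρ) _ _)
    (λ {x} {y} _ x<m _ _ e → <⇒≱ (<bound m ρ x<m) (≤-trans (m≤m+n (bound m ρ) y) (≤-reflexive (sym e))))
  injective : Injective _≡_ _≡_ (glue m ρ (bound m ρ +_))
  injective = injectiveOn tt tt

-- Inference

inferH-app : ∀ {N c Γ σ c'} M xs → inferH N [] c ≡ just (Γ , σ , c') →
             inferH (app M N) xs c ≡ inferH M ((Γ , σ) ∷ xs) c'
inferH-app M xs eq rewrite eq = refl

inferH-lam-[] : ∀ {M c σ c'} → inferH M [] c ≡ just ([] , σ , c') →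
                inferH (lam M) [] c ≡ just ([] , ω ⇒ σ , c')
inferH-lam-[] eq rewrite eq = refl

inferH-lam-∷ : ∀ {M c u Γ σ c'} → inferH M [] c ≡ just (u ∷ Γ , σ , c') →
               inferH (lam M) [] c ≡ just (Γ , u ⇒ σ , c')
inferH-lam-∷ eq rewrite eq = refl

∧C-cancel-singleton : ∀ {τ τ' Γ Δ} → [ [ τ ] ] ∧C Γ ≡ [ [ τ' ] ] ∧C Δ →
                      τ ≡ τ' × (∀ u Θ → (u ∷ Θ) ∧C Γ ≡ (u ∷ Θ) ∧C Δ)
∧C-cancel-singleton {Γ = []}    {[]}    refl = refl , λ u Θ → refl
∧C-cancel-singleton {Γ = []}    {_ ∷ _} refl = refl , λ u Θ → cong₂ _∷_ (sym (++-identityʳ u)) (sym (∧C-identityʳ Θ))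
∧C-cancel-singleton {Γ = _ ∷ _} {[]}    refl = refl , λ u Θ → cong₂ _∷_ (++-identityʳ u) (∧C-identityʳ Θ)
∧C-cancel-singleton {Γ = _ ∷ _} {_ ∷ _} refl = refl , λ u Θ → refl

at-∧C-nonempty : ∀ k τ Γ → ∃₂ λ u Θ → at k τ ∧C Γ ≡ u ∷ Θ
at-∧C-nonempty zero    τ []      = _ , _ , refl
at-∧C-nonempty zero    τ (_ ∷ _) = _ , _ , refl
at-∧C-nonempty (suc k) τ []      = _ , _ , refl
at-∧C-nonempty (suc k) τ (_ ∷ _) = _ , _ , refl

at-∧C-extend : ∀ {τ τ' Γ' Δ'} k σ Γ → [ [ τ ] ] ∧C Γ' ≡ [ [ τ' ] ] ∧C Δ' →
               at k ([ σ ] ⇒ τ) ∧C (Γ ∧C Γ') ≡ at k ([ σ ] ⇒ τ') ∧C (Γ ∧C Δ')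
at-∧C-extend {τ} {τ'} {Γ'} {Δ'} k σ Γ eq with ∧C-cancel-singleton {τ} {τ'} {Γ'} {Δ'} eq
... | refl , tails with at-∧C-nonempty k ([ σ ] ⇒ τ) Γ
... | u , Θ , nonempty = begin
  at k S ∧C (Γ ∧C Γ')     ≡⟨ sym (∧C-assoc (at k S) Γ Γ') ⟩
  (at k S ∧C Γ) ∧C Γ'     ≡⟨ cong (_∧C Γ') nonempty ⟩
  (u ∷ Θ) ∧C Γ'           ≡⟨ tails u Θ ⟩
  (u ∷ Θ) ∧C Δ'           ≡⟨ cong (_∧C Δ') (sym nonempty) ⟩
  (at k S ∧C Γ) ∧C Δ'     ≡⟨ ∧C-assoc (at k S) Γ Δ' ⟩
  at k S ∧C (Γ ∧C Δ')     ∎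
  where
  open ≡-Reasoning
  S = [ σ ] ⇒ τ

-- Defs computes the head context of a variable with private helpers; they agree with
-- spine and ⋀C, which is read off from the k = 0 instance one argument shorter.
inferH-var : ∀ rs k c → inferH (var k) rs c ≡
             just (at k (spine (map proj₂ rs) c) ∧C ⋀C (map proj₁ rs) , tv c , suc c)
inferH-var []                 k c = cong (λ Γ → just (Γ , tv c , suc c)) (sym (∧C-identityʳ (at k (tv c))))
inferH-var ((Γ , σ) ∷ [])     k c = refl
inferH-var ((Γ , σ) ∷ r ∷ rs) k c =
  cong (λ Δ → just (Δ , tv c , suc c)) (at-∧C-extend k σ Γ (cong context (inferH-var (r ∷ rs) 0 c)))
  where
  context : Maybe (Ctx × Ty × ℕ) → Ctx
  context (just (Δ , _ , _)) = Δ
  context nothing            = []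

record Inferred (c : ℕ) (N : Tm) (Γ : Ctx) (φ : Ty) : Set where
  constructor inferred-as
  field
    Γ₀ : Ctx
    σ₀ : Ty
    c' : ℕ
    ρ  : ℕ → ℕ
    infer          : inferH N [] c ≡ just (Γ₀ , σ₀ , c')
    renames-ctx    : renC ρ Γ₀ ≈C Γ
    renames-ty     : renT ρ σ₀ ≈T φ
    occurs⇒between : ∀ {x} → Occurs x Γ₀ σ₀ → Between c c' x
    between⇒occurs : ∀ {x} → Between c c' x → Occurs x Γ₀ σ₀
    injective      : InjectiveOn (Between c c') ρ
    c≤c'           : c ≤ c'

  image : ∀ {x} → Between c c' x → Occurs (ρ x) Γ φ
  image b = Occurs-ren renames-ctx renames-ty (between⇒occurs b)

record InferredArgs (c : ℕ) (Ns : List Tm) (Γs : List Ctx) (φs : List Ty) : Set where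
  constructor inferred-args-as
  field
    rs : List (Ctx × Ty)
    c' : ℕ
    ρ  : ℕ → ℕ
    infer          : ∀ M args → inferH (apps M Ns) args c ≡ inferH M (rs ++ args) c'
    renames-ctx    : renC ρ (⋀C (map proj₁ rs)) ≈C ⋀C Γs
    renames-tys    : Pointwise _≈T_ (renU ρ (map proj₂ rs)) φs
    occurs⇒between : ∀ {x} → OccursArgs x (map proj₁ rs) (map proj₂ rs) → Between c c' x
    between⇒occurs : ∀ {x} → Between c c' x → OccursArgs x (map proj₁ rs) (map proj₂ rs)
    injective      : InjectiveOn (Between c c') ρ
    c≤c'           : c ≤ c'

  image : ∀ {x} → Between c c' x → OccursArgs (ρ x) Γs φs
  image b = OccursArgs-ren {Γ₀s = map proj₁ rs} {Γs = Γs} renames-ctx renames-tys (between⇒occurs b)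

inferred-lamω : ∀ {c N φ} → Inferred c N [] φ → Inferred c (lam N) [] (ω ⇒ φ)
inferred-lamω {c} {N} (inferred-as [] σ₀ c' ρ infer [] rσ occurs⇒between between⇒occurs injective c≤c') =
  inferred-as [] (ω ⇒ σ₀) c' ρ (inferH-lam-[] {N} infer) [] (arr [] rσ) bounded covered injective c≤c'
  where
  bounded : ∀ {x} → Occurs x [] (ω ⇒ σ₀) → Between c c' x
  bounded (inj₂ (cod m)) = occurs⇒between (inj₂ m)
  covered : ∀ {x} → Between c c' x → Occurs x [] (ω ⇒ σ₀)
  covered b with between⇒occurs b
  ... | inj₂ m = inj₂ (cod m)

inferred-lam : ∀ {c N v Γ φ} → Inferred c N (v ∷ Γ) φ → Inferred c (lam N) Γ (v ⇒ φ)
inferred-lam {c} {N} (inferred-as (u ∷ Γ₀) σ₀ c' ρ infer (ru ∷ rΓ) rσ occurs⇒between between⇒occurs injective c≤c') =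
  inferred-as Γ₀ (u ⇒ σ₀) c' ρ (inferH-lam-∷ {N} infer) rΓ (arr ru rσ) bounded covered injective c≤c'
  where
  bounded : ∀ {x} → Occurs x Γ₀ (u ⇒ σ₀) → Between c c' x
  bounded (inj₁ m)       = occurs⇒between (inj₁ (there m))
  bounded (inj₂ (dom m)) = occurs⇒between (inj₁ (here m))
  bounded (inj₂ (cod m)) = occurs⇒between (inj₂ m)
  covered : ∀ {x} → Between c c' x → Occurs x Γ₀ (u ⇒ σ₀)
  covered b with between⇒occurs b
  ... | inj₁ (here m)  = inj₂ (dom m)
  ... | inj₁ (there m) = inj₁ m
  ... | inj₂ m         = inj₂ (cod m)

inferred-args-[] : ∀ c → InferredArgs c [] [] []
inferred-args-[] c =
  inferred-args-as [] c id (λ M args → refl) [] [] (λ { (inj₁ ()) ; (inj₂ ()) })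
    (λ (c≤x , x<c) → contradiction c≤x (<⇒≱ x<c))
    (λ (c≤x , x<c) → contradiction c≤x (<⇒≱ x<c)) ≤-refl

inferred-args-∷ : ∀ {c N Ns Γ Γs φ φs} (R : InferredArgs c Ns Γs φs) → Inferred (InferredArgs.c' R) N Γ φ →
                  (∀ {b} → Occurs b Γ φ → ¬ OccursArgs b Γs φs) →
                  InferredArgs c (N ∷ Ns) (Γ ∷ Γs) (φ ∷ φs)
inferred-args-∷ {c} {N} {Ns} {Γ} {Γs} {φ} {φs} R R₁ disjoint =
  inferred-args-as ((G , s) ∷ R.rs) c₂ ρ′ infer′ renames-ctx′ renames-tys′ bounded covered injective′
    (≤-trans R.c≤c' R₁.c≤c')
  where
  module R = InferredArgs R
  module R₁ = Inferred R₁
  G = R₁.Γ₀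
  s = R₁.σ₀
  c₁ = R.c'
  c₂ = R₁.c'
  Γ₀s = map proj₁ R.rs
  σ₀s = map proj₂ R.rs
  ρ′ = glue c₁ R.ρ R₁.ρ

  agrees-args : ∀ {x} → OccursArgs x Γ₀s σ₀s → ρ′ x ≡ R.ρ x
  agrees-args m = glue-< (proj₂ (R.occurs⇒between m))
  agrees-new : ∀ {x} → Occurs x G s → ρ′ x ≡ R₁.ρ x
  agrees-new m = glue-≥ (proj₁ (R₁.occurs⇒between m))

  infer′ : ∀ M args → inferH (apps M (N ∷ Ns)) args c ≡ inferH M ((G , s) ∷ R.rs ++ args) c₂
  infer′ M args = ≡.trans (R.infer (app M N) args) (inferH-app {N} M (R.rs ++ args) R₁.infer)
  renames-ctx′ : renC ρ′ (G ∧C ⋀C Γ₀s) ≈C (Γ ∧C ⋀C Γs)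
  renames-ctx′ = subst (_≈C (Γ ∧C ⋀C Γs))
    (sym (≡.trans (renC-∧C ρ′ G (⋀C Γ₀s))
                  (cong₂ _∧C_ (renC-cong-∈ G (λ m → agrees-new (inj₁ m)))
                              (renC-cong-∈ (⋀C Γ₀s) (λ m → agrees-args (inj₁ m))))))
    (∧C-cong R₁.renames-ctx R.renames-ctx)
  renames-tys′ : Pointwise _≈T_ (renU ρ′ (s ∷ σ₀s)) (φ ∷ φs)
  renames-tys′ =
    subst (_≈T φ) (sym (renT-cong-∈ s (λ m → agrees-new (inj₂ m)))) R₁.renames-ty ∷
    subst (λ u → Pointwise _≈T_ u φs) (sym (renU-cong-∈ σ₀s (λ m → agrees-args (inj₂ m)))) R.renames-tys
  bounded : ∀ {x} → OccursArgs x (G ∷ Γ₀s) (s ∷ σ₀s) → Between c c₂ x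
  bounded m with OccursArgs-∷⁻ {Γ = G} {Γs = Γ₀s} m
  ... | inj₁ m′ = let (c₁≤x , x<c₂) = R₁.occurs⇒between m′ in ≤-trans R.c≤c' c₁≤x , x<c₂
  ... | inj₂ m′ = let (c≤x , x<c₁) = R.occurs⇒between m′ in c≤x , <-≤-trans x<c₁ R₁.c≤c'
  covered : ∀ {x} → Between c c₂ x → OccursArgs x (G ∷ Γ₀s) (s ∷ σ₀s)
  covered {x} (c≤x , x<c₂) with ≤-<-connex c₁ x
  ... | inj₁ c₁≤x = OccursArgs-∷⁺ˡ {Γs = Γ₀s} (R₁.between⇒occurs (c₁≤x , x<c₂))
  ... | inj₂ x<c₁ = OccursArgs-∷⁺ʳ {Γ = G} {Γs = Γ₀s} (R.between⇒occurs (c≤x , x<c₁))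
  apart : ∀ {x y} → Between c c₁ x → Between c₁ c₂ y → R.ρ x ≢ R₁.ρ y
  apart x∈ y∈ e = disjoint (R₁.image y∈) (subst (λ b → OccursArgs b Γs φs) e (R.image x∈))
  injective′ : InjectiveOn (Between c c₂) ρ′
  injective′ = glue-injectiveOn-Between R.injective R₁.injective apart

Occurs-head⁻ : ∀ {x} k σs c Γs → Occurs x (at k (spine σs c) ∧C ⋀C Γs) (tv c) → x ≡ c ⊎ OccursArgs x Γs σs
Occurs-head⁻ k σs c Γs (inj₂ here) = inj₁ refl
Occurs-head⁻ k σs c Γs (inj₁ m) with ∈C-∧C⁻ (at k (spine σs c)) (⋀C Γs) m
... | inj₂ m′ = inj₂ (inj₁ m′)
... | inj₁ m′ with ∈T-spine⁻ σs c (∈C-at⁻ k m′)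
...   | inj₁ x≡c  = inj₁ x≡c
...   | inj₂ m″   = inj₂ (inj₂ m″)

Occurs-head⁺ : ∀ {x} k σs c Γs → OccursArgs x Γs σs → Occurs x (at k (spine σs c) ∧C ⋀C Γs) (tv c)
Occurs-head⁺ k σs c Γs (inj₁ m) = inj₁ (∈C-∧C⁺ʳ (at k (spine σs c)) m)
Occurs-head⁺ k σs c Γs (inj₂ m) = inj₁ (∈C-∧C⁺ˡ (⋀C Γs) (∈C-at⁺ k (∈T-spine⁺ σs c (inj₂ m))))

-- The head variable takes the next fresh variable c₁, renamed to a.
inferred-head : ∀ {c k Ns Γ Γs φs a} → InferredArgs c Ns Γs φs →
                Γ ≈C (at k (spine φs a) ∧C ⋀C Γs) → ¬ OccursArgs a Γs φs →
                Inferred c (apps (var k) Ns) Γ (tv a)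
inferred-head {c} {k} {Ns} {Γ} {Γs} {φs} {a} R eq a∉args =
  inferred-as Γ₀ (tv c₁) (suc c₁) ρ′ infer′ renames-ctx′ renames-ty′ bounded covered injective′
    (m≤n⇒m≤1+n R.c≤c')
  where
  module R = InferredArgs R
  c₁ = R.c'
  Γ₀s = map proj₁ R.rs
  σ₀s = map proj₂ R.rs
  Γ₀ = at k (spine σ₀s c₁) ∧C ⋀C Γ₀s
  ρ′ = glue c₁ R.ρ (const a)

  agrees : ∀ {x} → OccursArgs x Γ₀s σ₀s → ρ′ x ≡ R.ρ x
  agrees m = glue-< (proj₂ (R.occurs⇒between m))
  ρ′c₁≡a : ρ′ c₁ ≡ a
  ρ′c₁≡a = glue-≥ {c₁} {R.ρ} {const a} ≤-refl

  infer′ : inferH (apps (var k) Ns) [] c ≡ just (Γ₀ , tv c₁ , suc c₁)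
  infer′ = ≡.trans (R.infer (var k) [])
           (≡.trans (cong (λ rs → inferH (var k) rs c₁) (++-identityʳ R.rs)) (inferH-var R.rs k c₁))
  renamed : renC ρ′ Γ₀ ≡ at k (spine (renU R.ρ σ₀s) a) ∧C renC R.ρ (⋀C Γ₀s)
  renamed = begin
    renC ρ′ Γ₀                                                      ≡⟨ renC-∧C ρ′ (at k _) (⋀C Γ₀s) ⟩
    renC ρ′ (at k (spine σ₀s c₁)) ∧C renC ρ′ (⋀C Γ₀s)                ≡⟨ cong₂ _∧C_ (renC-at ρ′ k _)
                                                                          (renC-cong-∈ (⋀C Γ₀s) (λ m → agrees (inj₁ m))) ⟩
    at k (renT ρ′ (spine σ₀s c₁)) ∧C renC R.ρ (⋀C Γ₀s)               ≡⟨ cong (λ τ → at k τ ∧C _) (renT-spine ρ′ σ₀s c₁) ⟩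
    at k (spine (renU ρ′ σ₀s) (ρ′ c₁)) ∧C renC R.ρ (⋀C Γ₀s)          ≡⟨ cong₂ (λ u b → at k (spine u b) ∧C _)
                                                                          (renU-cong-∈ σ₀s (λ m → agrees (inj₂ m))) ρ′c₁≡a ⟩
    at k (spine (renU R.ρ σ₀s) a) ∧C renC R.ρ (⋀C Γ₀s)               ∎
    where open ≡-Reasoning
  renames-ctx′ : renC ρ′ Γ₀ ≈C Γ
  renames-ctx′ = subst (_≈C Γ) (sym renamed)
    (≈C-trans (∧C-cong (at-cong k (spine-cong a R.renames-tys)) R.renames-ctx) (≈C-sym eq))
  renames-ty′ : renT ρ′ (tv c₁) ≈T tv a
  renames-ty′ = subst (λ b → tv b ≈T tv a) (sym ρ′c₁≡a) tv

  bounded : ∀ {x} → Occurs x Γ₀ (tv c₁) → Between c (suc c₁) x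
  bounded m with Occurs-head⁻ k σ₀s c₁ Γ₀s m
  ... | inj₁ refl = R.c≤c' , ≤-refl
  ... | inj₂ m′   = let (c≤x , x<c₁) = R.occurs⇒between m′ in c≤x , m≤n⇒m≤1+n x<c₁
  covered : ∀ {x} → Between c (suc c₁) x → Occurs x Γ₀ (tv c₁)
  covered (c≤x , x<1+c₁) with m<1+n⇒m<n∨m≡n x<1+c₁
  ... | inj₁ x<c₁ = Occurs-head⁺ k σ₀s c₁ Γ₀s (R.between⇒occurs (c≤x , x<c₁))
  ... | inj₂ refl = inj₂ here
  apart : ∀ {x y} → Between c c₁ x → Between c₁ (suc c₁) y → R.ρ x ≢ a
  apart x∈ _ e = a∉args (subst (λ b → OccursArgs b Γs φs) e (R.image x∈))
  singleton : InjectiveOn (Between c₁ (suc c₁)) (const a)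
  singleton (c₁≤x , x<1+c₁) (c₁≤y , y<1+c₁) _ =
    ≡.trans (≤-antisym (≤-pred x<1+c₁) c₁≤x) (sym (≤-antisym (≤-pred y<1+c₁) c₁≤y))
  injective′ : InjectiveOn (Between c (suc c₁)) ρ′
  injective′ = glue-injectiveOn-Between R.injective singleton apart

mutual
  inferred : ∀ {Γ φ} (P : Principal Γ φ) c → Inferred c (term P) Γ φ
  inferred (pa {a} k _) c =
    inferred-head (inferred-args-[] c) (≡⇒≈C (sym (∧C-identityʳ (at k (tv a))))) λ { (inj₁ ()) ; (inj₂ ()) }
  inferred (pb _ P) c = inferred-lamω (inferred P c)
  inferred (pc _ _ P) c = inferred-lam (inferred P c)
  inferred (pd {Γ} {a} k φs Γs (_ , cl , _) eq Ps) c = inferred-head (inferred-args Ps linear c) eq a∉args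
    where
    positive : ∀ b → occArgs b Γs φs + occT true b (tv a) ≤ 1
    positive b = subst (_≤ 1) (occ-head k φs a Γs b eq) (Closed⇒occ≤1 {⟨ Γ ⟩⇒ tv a} cl true b)
    linear : ∀ b → occArgs b Γs φs ≤ 1
    linear b = m+n≤o⇒m≤o _ (positive b)
    a∉args : ¬ OccursArgs a Γs φs
    a∉args m = contradiction (≤-trans (+-mono-≤ (OccursArgs⇒occArgs Ps m) (≤-reflexive (sym (occT-self a))))
                                      (positive a))
                             λ { (s≤s ()) }

  -- Each variable occurs positively at most once among the arguments, so the arguments
  -- have pairwise disjoint variables.
  inferred-args : ∀ {Γs φs} (Ps : PrincipalAll Γs φs) → (∀ b → occArgs b Γs φs ≤ 1) →
                  ∀ c → InferredArgs c (terms Ps) Γs φs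
  inferred-args [] _ c = inferred-args-[] c
  inferred-args {Γ ∷ Γs} {φ ∷ φs} (P ∷ Ps) linear c =
    inferred-args-∷ R (inferred P (InferredArgs.c' R)) disjoint
    where
    split : ∀ b → occ true b (⟨ Γ ⟩⇒ φ) + occArgs b Γs φs ≤ 1
    split b = subst (_≤ 1) (occArgs-∷ b Γ Γs φ φs) (linear b)
    R = inferred-args Ps (λ b → m+n≤o⇒n≤o (occ true b (⟨ Γ ⟩⇒ φ)) (split b)) c
    disjoint : ∀ {b} → Occurs b Γ φ → ¬ OccursArgs b Γs φs
    disjoint {b} m m′ = contradiction
      (≤-trans (+-mono-≤ (≤-reflexive (sym once)) (OccursArgs⇒occArgs Ps m′)) (split b))
      λ { (s≤s ()) }
      where
      once : occ true b (⟨ Γ ⟩⇒ φ) ≡ 1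
      once = Closed⇒occ≡1 {⟨ Γ ⟩⇒ φ} (Principal⇒Closed P) (proj₂ (Occurs⇒occ m)) true

Inferred⇒InferIs : ∀ {N Γ φ} → Inferred 0 N Γ φ → InferIs N Γ φ
Inferred⇒InferIs {Γ = Γ} {φ} (inferred-as Γ₀ σ₀ c' ρ infer rΓ rσ occurs⇒between _ injective _)
  with InjectiveOn-extend c' ρ injective
... | ρ′ , ρ′-injective , ρ′≗ρ =
  ρ′ , ρ′-injective , Γ₀ , σ₀ , c' , infer ,
  subst (_≈C Γ) (sym (renC-cong-∈ Γ₀ (λ m → ρ′≗ρ (proj₂ (occurs⇒between (inj₁ m)))))) rΓ ,
  subst (_≈T φ) (sym (renT-cong-∈ σ₀ (λ m → ρ′≗ρ (proj₂ (occurs⇒between (inj₂ m)))))) rσ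

lemma3p25 : (Γ : Ctx) (φ : Ty) → Principal Γ φ →
    Σ Tm (λ N → Recon Γ φ N [] × BetaNF N × InferIs N Γ φ)
lemma3p25 Γ φ P = term P , recon P , term-BetaNF P , Inferred⇒InferIs (inferred P 0)
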